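{- Let $s$ be a non-empty string, $s'=s[1..|s|-1]$, $t=\mathit{sufpal}(s,|s|)$, and let $t'$ be the longest proper palindromic suffix of $t$ (possibly empty). Then for $1\le i\le|s|-1$, \[ \mathit{presurf}(s',i)=\begin{cases} t', & i=|s|-|t|+1 \text{ and } |\mathit{sufsurf}(s,|s|-|t|+|t'|)|<|t'|,\\ \epsilon, & i=|s|-|t|+1 \text{ and } |\mathit{sufsurf}(s,|s|-|t|+|t'|)|\ge|t'|,\\ \mathit{presurf}(s,i), & \text{otherwise},\end{cases} \] and \[ \mathit{sufsurf}(s',i)=\begin{cases} t', & i=|s|-|t|+|t'| \text{ and } |\mathit{sufsurf}(s,|s|-|t|+|t'|)|<|t'|,\\ \mathit{sufsurf}(s,i), & \text{otherwise}.\end{cases} \]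
   Context: $s[i..j]=s[i]\cdots s[j]$; $\epsilon$ is the empty string; a palindrome is a string equal to its reverse. For $1\le i\le|s|$: $\mathit{prelen}(s,i)$ is the length of the longest (non-empty) palindromic prefix $\mathit{prepal}(s,i)$ of $s[i..|s|]$, and $\mathit{suflen}(s,i)$ is the length of the longest palindromic suffix $\mathit{sufpal}(s,i)$ of $s[1..i]$. A non-empty palindromic substring $s[i..j]$ is a surface in $s$ if neither $s[i..r]$ nor $s[l..j]$ is a palindrome for any $1\le l<i\le j<r\le|s|$. Define $\mathit{presurf}(s,i)=\mathit{prepal}(s,i)$ if $s[i..i+\mathit{prelen}(s,i)-1]$ is a surface in $s$, and $\epsilon$ otherwise; $\mathit{sufsurf}(s,i)=\mathit{sufpal}(s,i)$ if $s[i-\mathit{suflen}(s,i)+1..i]$ is a surface in $s$, and $\epsilon$ otherwise. -}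

module Defs where

open import Data.Nat using (ℕ; zero; suc; _+_; _∸_; _≤_; _<_; _≤?_; _<?_)
open import Data.Nat.Properties using (allUpTo?)
open import Data.List using (List; []; _∷_; length; take; drop; reverse)
open import Data.List.Properties using (≡-dec)
open import Data.Product using (_×_)
open import Data.Bool using (if_then_else_)
open import Relation.Nullary using (¬_; Dec; does)
open import Relation.Nullary.Decidable using (_×-dec_; _→-dec_; ¬?)
open import Relation.Binary.Definitions using (DecidableEquality)
open import Relation.Binary.PropositionalEquality using (_≡_)

-- Strings over an alphabet A with decidable equality; positions are 1-indexed.
module Strings {A : Set} (_≟_ : DecidableEquality A) where

  -- s[i..j] = s[i] ⋯ s[j]  (empty when j < i)
  sub : List A → ℕ → ℕ → List A
  sub s i j = take (suc j ∸ i) (drop (i ∸ 1) s)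

  IsPal : List A → Set
  IsPal w = reverse w ≡ w

  pal? : (w : List A) → Dec (IsPal w)
  pal? w = ≡-dec _≟_ (reverse w) w

  lastN : ℕ → List A → List A
  lastN m w = drop (length w ∸ m) w

  -- largest m ≤ k such that the prefix of w of length m is a palindrome
  -- (returns 0 if there is none among 1..k)
  maxPalPre : List A → ℕ → ℕ
  maxPalPre w zero = zero
  maxPalPre w (suc k) = if does (pal? (take (suc k) w)) then suc k else maxPalPre w k

  maxPalSuf : List A → ℕ → ℕ
  maxPalSuf w zero = zero
  maxPalSuf w (suc k) = if does (pal? (lastN (suc k) w)) then suc k else maxPalSuf w k

  prelen : List A → ℕ → ℕ
  prelen s i = maxPalPre (drop (i ∸ 1) s) (length (drop (i ∸ 1) s))

  prepal : List A → ℕ → List A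
  prepal s i = take (prelen s i) (drop (i ∸ 1) s)

  suflen : List A → ℕ → ℕ
  suflen s i = maxPalSuf (take i s) (length (take i s))

  sufpal : List A → ℕ → List A
  sufpal s i = lastN (suflen s i) (take i s)

  NoRightExt : List A → ℕ → ℕ → Set
  NoRightExt s i j = ∀ {r} → r < suc (length s) → j < r → ¬ IsPal (sub s i r)

  NoLeftExt : List A → ℕ → ℕ → Set
  NoLeftExt s i j = ∀ {l} → l < i → 1 ≤ l → ¬ IsPal (sub s l j)

  IsSurface : List A → ℕ → ℕ → Set
  IsSurface s i j =
    (1 ≤ i) × (i ≤ j) × (j ≤ length s) × IsPal (sub s i j) × NoRightExt s i j × NoLeftExt s i j

  surface? : (s : List A) (i j : ℕ) → Dec (IsSurface s i j)
  surface? s i j =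
    (1 ≤? i) ×-dec (i ≤? j) ×-dec (j ≤? length s) ×-dec pal? (sub s i j)
      ×-dec allUpTo? (λ r → (j <? r) →-dec ¬? (pal? (sub s i r))) (suc (length s))
      ×-dec allUpTo? (λ l → (1 ≤? l) →-dec ¬? (pal? (sub s l j))) i
    where open import Data.Nat using (_≤?_)

  presurf : List A → ℕ → List A
  presurf s i = if does (surface? s i (i + prelen s i ∸ 1)) then prepal s i else []

  sufsurf : List A → ℕ → List A
  sufsurf s i = if does (surface? s (suc i ∸ suflen s i) i) then sufpal s i else []

  properPalSuf : List A → List A
  properPalSuf w = lastN (maxPalSuf w (length w ∸ 1)) w

module Submission where

-- Let t = w[a..e] be the longest palindromic suffix of w and t′ = w[b..e] the longest proper
-- palindromic suffix of t. Deleting the last letter only matters for palindromes that could be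
-- extended to the right up to position e, i.e. that are concentric with a palindromic suffix w[x..e],
-- and then x ≥ a. If x > a, reflecting inside t gives a left extension, so the factor is a surface
-- neither before nor after the deletion. If x = a, reflecting inside t shows that the longest
-- palindrome starting at a in the shortened string is the mirror image w[a..c] of t′, since a longer
-- one would reflect to a palindromic suffix of t longer than t′. It is a surface exactly when the
-- longest palindrome of w ending at c starts at a, i.e. when |sufsurf(w, c)| < |t′|: if that
-- palindrome starts earlier, two palindromes with a common start force a period which rules out
-- every right extension, so it is a surface longer than t′.

open import Data.Nat using (ℕ; zero; suc; _+_; _*_; _∸_; _≤_; _<_; _≥_; z≤n; s≤s; z<s; _<?_; _≤?_)
open import Data.Nat.Properties hiding (_≟_)
open import Data.Nat.Properties as ℕ using ()
open import Data.Nat.DivMod using (_/_; _%_; m≡m%n+[m/n]*n; m%n<n)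
open import Data.Nat.Tactic.RingSolver using (solve-∀)
open import Data.List using (List; []; _∷_; length; drop; take; reverse; _++_)
open import Data.List.Properties using (length-reverse; unfold-reverse; length-take; length-drop)
open import Data.Maybe using (Maybe; just; nothing)
open import Data.Maybe.Properties using (just-injective)
open import Data.Product using (_×_; _,_; proj₂; ∃-syntax)
open import Data.Sum using (inj₁; inj₂)
open import Data.Bool using (if_then_else_)
open import Data.Empty using (⊥-elim)
open import Function using (_∘_)
open import Relation.Nullary using (¬_; Dec; yes; no; does)
open import Relation.Nullary.Decidable using (dec-true; dec-false; map′)
open import Relation.Binary.Definitions using (DecidableEquality; tri<; tri≈; tri>)
open import Relation.Binary.PropositionalEquality
open import Defs

+≡+⇒≤ˡ : ∀ {a b c d} → a + b ≡ c + d → a ≤ c → d ≤ b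
+≡+⇒≤ˡ {a} {b} {c} {d} eq a≤c = +-cancelˡ-≤ c d b (subst (_≤ c + b) eq (+-monoˡ-≤ b a≤c))

+≡+⇒≤ʳ : ∀ {a b c d} → a + b ≡ c + d → b ≤ d → c ≤ a
+≡+⇒≤ʳ {a} {b} {c} {d} eq = +≡+⇒≤ˡ (trans (+-comm b a) (trans eq (+-comm c d)))

+≡+⇒<ˡ : ∀ {a b c d} → a + b ≡ c + d → a < c → d < b
+≡+⇒<ˡ {a} {b} {c} {d} eq = +≡+⇒≤ˡ {suc a} {b} {c} {suc d} (trans (cong suc eq) (sym (+-suc c d)))

module _ {A : Set} where

  index : List A → ℕ → Maybe A
  index []       _       = nothing
  index (x ∷ xs) zero    = just x
  index (x ∷ xs) (suc k) = index xs k

  index-ext : ∀ (v w : List A) → (∀ k → index v k ≡ index w k) → v ≡ w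
  index-ext []      []      _ = refl
  index-ext []      (_ ∷ _) h with h 0
  ... | ()
  index-ext (_ ∷ _) []      h with h 0
  ... | ()
  index-ext (x ∷ v) (y ∷ w) h = cong₂ _∷_ (just-injective (h 0)) (index-ext v w (h ∘ suc))

  index-≥length : ∀ (w : List A) k → length w ≤ k → index w k ≡ nothing
  index-≥length []      k       _         = refl
  index-≥length (x ∷ w) (suc k) (s≤s le) = index-≥length w k le

  index-<length : ∀ (w : List A) k → k < length w → index w k ≢ nothing
  index-<length (x ∷ w) zero    _         ()
  index-<length (x ∷ w) (suc k) (s≤s lt) = index-<length w k lt

  index-drop : ∀ (w : List A) x k → index (drop x w) k ≡ index w (x + k)
  index-drop w       zero    k = refl
  index-drop []      (suc x) k = refl
  index-drop (y ∷ w) (suc x) k = index-drop w x k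

  index-take-< : ∀ (w : List A) m k → k < m → index (take m w) k ≡ index w k
  index-take-< []      (suc m) k       _         = refl
  index-take-< (y ∷ w) (suc m) zero    _         = refl
  index-take-< (y ∷ w) (suc m) (suc k) (s≤s lt) = index-take-< w m k lt

  index-take-≥ : ∀ (w : List A) m k → m ≤ k → index (take m w) k ≡ nothing
  index-take-≥ w       zero    k       _         = refl
  index-take-≥ []      (suc m) k       _         = refl
  index-take-≥ (y ∷ w) (suc m) (suc k) (s≤s le) = index-take-≥ w m k le

  index-reverse : ∀ (w : List A) u v → suc (u + v) ≡ length w → index (reverse w) u ≡ index w v
  index-reverse (x ∷ w) u zero eq rewrite unfold-reverse x w =
    index-++-length (reverse w) u (trans (trans (sym (+-identityʳ u)) (suc-injective eq)) (sym (length-reverse w)))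
    where
    index-++-length : ∀ (xs : List A) k → k ≡ length xs → index (xs ++ x ∷ []) k ≡ just x
    index-++-length []       .0                   refl = refl
    index-++-length (_ ∷ xs) .(suc (length xs)) refl = index-++-length xs _ refl
  index-reverse (x ∷ w) u (suc v) eq rewrite unfold-reverse x w =
    trans (index-++ˡ (reverse w) u u<len) (index-reverse w u v eq′)
    where
    index-++ˡ : ∀ (xs : List A) k → k < length xs → index (xs ++ x ∷ []) k ≡ index xs k
    index-++ˡ (_ ∷ xs) zero    _         = refl
    index-++ˡ (_ ∷ xs) (suc k) (s≤s lt) = index-++ˡ xs k lt
    eq′ : suc (u + v) ≡ length w
    eq′ = trans (sym (+-suc u v)) (suc-injective eq)
    u<len : u < length (reverse w)
    u<len = subst (u <_) (trans eq′ (sym (length-reverse w))) (s≤s (m≤m+n u v))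

  palindrome⇒index : ∀ (w : List A) → reverse w ≡ w → ∀ u v → suc (u + v) ≡ length w → index w u ≡ index w v
  palindrome⇒index w pal u v eq = trans (cong (λ z → index z u) (sym pal)) (index-reverse w u v eq)

  index⇒palindrome : ∀ (w : List A) → (∀ u v → suc (u + v) ≡ length w → index w u ≡ index w v) → reverse w ≡ w
  index⇒palindrome w h = index-ext (reverse w) w pointwise
    where
    pointwise : ∀ k → index (reverse w) k ≡ index w k
    pointwise k with k <? length w
    ... | yes k<len = let (v , eq) = m≤n⇒∃[o]m+o≡n k<len in trans (index-reverse w k v eq) (sym (h k v eq))
    ... | no k≮len  = trans (index-≥length (reverse w) k (subst (_≤ k) (sym (length-reverse w)) (≮⇒≥ k≮len)))
                            (sym (index-≥length w k (≮⇒≥ k≮len)))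

  -- z is the factor of w of length L starting at (0-indexed) position x.
  record Slice (z w : List A) (x L : ℕ) : Set where
    field
      inside  : ∀ k → k < L → index z k ≡ index w (x + k)
      outside : ∀ k → L ≤ k → index z k ≡ nothing
  open Slice public

  slice-≡ : ∀ {z z′ w w′ x x′ L} → Slice z w x L → Slice z′ w′ x′ L →
            (∀ k → k < L → index w (x + k) ≡ index w′ (x′ + k)) → z ≡ z′
  slice-≡ {z} {z′} {L = L} σ σ′ h = index-ext z z′ pointwise
    where
    pointwise : ∀ k → index z k ≡ index z′ k
    pointwise k with k <? L
    ... | yes k<L = trans (inside σ k k<L) (trans (h k k<L) (sym (inside σ′ k k<L)))
    ... | no k≮L  = trans (outside σ k (≮⇒≥ k≮L)) (sym (outside σ′ k (≮⇒≥ k≮L)))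

  slice-length : ∀ {z w x L} → Slice z w x L → x + L ≤ length w → length z ≡ L
  slice-length {z} {w} {x} {L} σ fits with <-cmp (length z) L
  ... | tri≈ _ eq _ = eq
  ... | tri< lt _ _ = ⊥-elim (index-<length w (x + length z) (<-≤-trans (+-monoʳ-< x lt) fits)
                        (trans (sym (inside σ (length z) lt)) (index-≥length z (length z) ≤-refl)))
  ... | tri> _ _ gt = ⊥-elim (index-<length z L gt (outside σ L ≤-refl))

  slice-self : ∀ (w : List A) → Slice w w 0 (length w)
  slice-self w = record { inside = λ _ _ → refl ; outside = index-≥length w }

  slice-take : ∀ {z w x M} L → Slice z w x M → L ≤ M → Slice (take L z) w x L
  slice-take {z} L σ L≤M = record
    { inside  = λ k k<L → trans (index-take-< z L k k<L) (inside σ k (<-≤-trans k<L L≤M))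
    ; outside = index-take-≥ z L }

  slice-drop : ∀ {z w x M} y → Slice z w x M → Slice (drop y z) w (x + y) (M ∸ y)
  slice-drop {z} {w} {x} {M} y σ = record
    { inside  = λ k k<M∸y → trans (index-drop z y k)
                  (trans (inside σ (y + k) (shifted k k<M∸y)) (cong (index w) (sym (+-assoc x y k))))
    ; outside = λ k M∸y≤k → trans (index-drop z y k) (outside σ (y + k) (≤-trans (m≤n+m∸n M y) (+-monoʳ-≤ y M∸y≤k))) }
    where
    shifted : ∀ k → k < M ∸ y → y + k < M
    shifted k k<M∸y = subst (y + k <_) (m+[n∸m]≡n y≤M) (+-monoʳ-< y k<M∸y)
      where
      y≤M : y ≤ M
      y≤M = <⇒≤ (m∸n≢0⇒n<m {M} {y} (λ eq → <⇒≱ k<M∸y (subst (_≤ k) (sym eq) z≤n)))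

  -- w[x..y], positions 0-indexed and inclusive, is a palindrome; vacuously true when y < x.
  record Palindromic (w : List A) (x y : ℕ) : Set where
    constructor palindromic
    field mirror : ∀ u v → u + v ≡ x + y → x ≤ u → u ≤ y → index w u ≡ index w v
  open Palindromic public

  slice-palindrome⇒ : ∀ {z w x d} → Slice z w x (suc d) → x + suc d ≤ length w → reverse z ≡ z →
                      Palindromic w x (x + d)
  slice-palindrome⇒ {z} {w} {x} {d} σ fits pal = palindromic matches
    where
    rearrange : ∀ x u v → x + (x + (u + v)) ≡ x + u + (x + v)
    rearrange = solve-∀
    matches : ∀ u v → u + v ≡ x + (x + d) → x ≤ u → u ≤ x + d → index w u ≡ index w v
    matches u v uv x≤u u≤x+d with m≤n⇒∃[o]m+o≡n x≤u
    ... | u′ , refl with m≤n⇒∃[o]m+o≡n (+-cancelˡ-≤ x u′ d u≤x+d)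
    ... | v′ , refl = begin
      index w (x + u′) ≡⟨ sym (inside σ u′ (s≤s (m≤m+n u′ v′))) ⟩
      index z u′       ≡⟨ palindrome⇒index z pal u′ v′ (sym (slice-length σ fits)) ⟩
      index z v′       ≡⟨ inside σ v′ (s≤s (m≤n+m v′ u′)) ⟩
      index w (x + v′) ≡⟨ cong (index w) (+-cancelˡ-≡ (x + u′) (x + v′) v (trans (sym (rearrange x u′ v′)) (sym uv))) ⟩
      index w v        ∎
      where open ≡-Reasoning

  slice-palindrome⇐ : ∀ {z w x d} → Slice z w x (suc d) → x + suc d ≤ length w → Palindromic w x (x + d) →
                      reverse z ≡ z
  slice-palindrome⇐ {z} {w} {x} {d} σ fits p = index⇒palindrome z matches
    where
    rearrange : ∀ x u v → x + u + (x + v) ≡ x + (x + (u + v))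
    rearrange = solve-∀
    matches : ∀ u v → suc (u + v) ≡ length z → index z u ≡ index z v
    matches u v eq = begin
      index z u       ≡⟨ inside σ u (s≤s (≤-trans (m≤m+n u v) (≤-reflexive u+v≡d))) ⟩
      index w (x + u) ≡⟨ mirror p (x + u) (x + v) (trans (rearrange x u v) (cong (λ k → x + (x + k)) u+v≡d))
                                (m≤m+n x u) (+-monoʳ-≤ x (≤-trans (m≤m+n u v) (≤-reflexive u+v≡d))) ⟩
      index w (x + v) ≡⟨ sym (inside σ v (s≤s (≤-trans (m≤n+m v u) (≤-reflexive u+v≡d)))) ⟩
      index z v       ∎
      where
      open ≡-Reasoning
      u+v≡d : u + v ≡ d
      u+v≡d = suc-injective (trans eq (slice-length σ fits))

  palindromic-empty : ∀ {w x y} → y < x → Palindromic w x y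
  palindromic-empty y<x = palindromic λ _ _ _ x≤u u≤y → ⊥-elim (<⇒≱ y<x (≤-trans x≤u u≤y))

  slice-palindromic : ∀ {z w x y} L → Slice z w x L → x + L ≡ suc y → y < length w → (0 < L → reverse z ≡ z) →
                      Palindromic w x y
  slice-palindromic {x = x} zero _ x+0≡ _ _ = palindromic-empty (≤-reflexive (trans (sym x+0≡) (+-identityʳ x)))
  slice-palindromic {w = w} {x} (suc l) σ x+L≡ y<len pal =
    subst (Palindromic w x) (suc-injective (trans (sym (+-suc x l)) x+L≡))
          (slice-palindrome⇒ σ (subst (_≤ length w) (sym x+L≡) y<len) (pal z<s))

  palindromic-single : ∀ {w} y → Palindromic w y y
  palindromic-single {w} y = palindromic λ u v uv y≤u u≤y →
    let u≡y = ≤-antisym u≤y y≤u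
    in cong (index w) (trans u≡y (sym (+-cancelˡ-≡ y v y (trans (cong (_+ v) (sym u≡y)) uv))))

  palindromic-transfer : ∀ {v w e x y} → (∀ k → k < e → index v k ≡ index w k) → y < e →
                         Palindromic v x y → Palindromic w x y
  palindromic-transfer agree y<e p = palindromic λ u u′ uu′ x≤u u≤y →
    trans (sym (agree u (≤-<-trans u≤y y<e)))
          (trans (mirror p u u′ uu′ x≤u u≤y) (agree u′ (≤-<-trans (+≡+⇒≤ˡ (sym uu′) x≤u) y<e)))

  palindromic-concentric : ∀ {w x y x′ y′} → Palindromic w x y → x ≤ x′ → x′ + y′ ≡ x + y → Palindromic w x′ y′
  palindromic-concentric p x≤x′ eq = palindromic λ u v uv x′≤u u≤y′ →
    mirror p u v (trans uv eq) (≤-trans x≤x′ x′≤u) (≤-trans u≤y′ (+≡+⇒≤ˡ (sym eq) x≤x′))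

  -- (x₂, y₂) is the mirror image of (x₁, y₁) about the centre of w[x..y].
  palindromic-reflect : ∀ {w x y x₁ y₁ x₂ y₂} → Palindromic w x y → Palindromic w x₁ y₁ → x ≤ x₁ → y₁ ≤ y →
                        x₂ + y₁ ≡ x + y → x₁ + y₂ ≡ x + y → Palindromic w x₂ y₂
  palindromic-reflect {w} {x} {y} {x₁} {y₁} {x₂} {y₂} outer inner x≤x₁ y₁≤y e₂ e₁ = palindromic matches
    where
    S = x + y
    y₂≤S : y₂ ≤ S
    y₂≤S = subst (y₂ ≤_) e₁ (m≤n+m y₂ x₁)
    x≤x₂ : x ≤ x₂
    x≤x₂ = +≡+⇒≤ʳ e₂ y₁≤y
    y₂≤y : y₂ ≤ y
    y₂≤y = +≡+⇒≤ˡ (sym e₁) x≤x₁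
    rearrange₁ : ∀ a b c d → a + b + (c + d) ≡ c + a + (d + b)
    rearrange₁ = solve-∀
    rearrange₂ : ∀ a b c d → a + b + (c + d) ≡ a + d + (c + b)
    rearrange₂ = solve-∀
    matches : ∀ u v → u + v ≡ x₂ + y₂ → x₂ ≤ u → u ≤ y₂ → index w u ≡ index w v
    matches u v uv x₂≤u u≤y₂ =
      trans (mirror outer u u′ uu′ (≤-trans x≤x₂ x₂≤u) (≤-trans u≤y₂ y₂≤y))
        (trans (mirror inner u′ v′ u′v′ x₁≤u′ u′≤y₁)
               (sym (mirror outer v v′ vv′ (≤-trans x≤x₂ x₂≤v) (≤-trans v≤y₂ y₂≤y))))
      where
      v≤y₂ : v ≤ y₂
      v≤y₂ = +≡+⇒≤ˡ (sym uv) x₂≤u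
      x₂≤v : x₂ ≤ v
      x₂≤v = +≡+⇒≤ʳ (trans (+-comm v u) uv) u≤y₂
      u′ = S ∸ u
      v′ = S ∸ v
      uu′ : u + u′ ≡ S
      uu′ = m+[n∸m]≡n (≤-trans u≤y₂ y₂≤S)
      vv′ : v + v′ ≡ S
      vv′ = m+[n∸m]≡n (≤-trans v≤y₂ y₂≤S)
      x₁≤u′ : x₁ ≤ u′
      x₁≤u′ = +≡+⇒≤ʳ (trans (+-comm u′ u) (trans uu′ (sym e₁))) u≤y₂
      u′≤y₁ : u′ ≤ y₁
      u′≤y₁ = +≡+⇒≤ˡ (trans e₂ (sym uu′)) x₂≤u
      u′v′ : u′ + v′ ≡ x₁ + y₁
      u′v′ = +-cancelʳ-≡ (u + v) (u′ + v′) (x₁ + y₁) (begin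
        u′ + v′ + (u + v)   ≡⟨ rearrange₁ u′ v′ u v ⟩
        u + u′ + (v + v′)   ≡⟨ cong₂ _+_ (trans uu′ (sym e₁)) (trans vv′ (sym e₂)) ⟩
        x₁ + y₂ + (x₂ + y₁) ≡⟨ rearrange₂ x₁ y₂ x₂ y₁ ⟩
        x₁ + y₁ + (x₂ + y₂) ≡⟨ cong ((x₁ + y₁) +_) (sym uv) ⟩
        x₁ + y₁ + (u + v)   ∎)
        where open ≡-Reasoning

  palindromic-shift : ∀ {w x y} g j → Palindromic w x y → Palindromic w x (y + g) →
                      Palindromic w (x + j * g) y × Palindromic w (x + j * g) (y + g)
  palindromic-shift {x = x} g zero p q rewrite +-identityʳ x = p , q
  palindromic-shift {x = x} {y} g (suc j) p q rewrite sym (+-assoc x g (j * g)) =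
    palindromic-shift g j (palindromic-concentric q (m≤m+n x g) shifted)
                          (palindromic-reflect q p ≤-refl (m≤m+n y g) shifted refl)
    where
    shifted : x + g + y ≡ x + (y + g)
    shifted = trans (+-assoc x g y) (cong (x +_) (+-comm g y))

  -- Two palindromes starting at K and ending g apart make w[K..y+g] g-periodic, so a palindrome
  -- reappears from every later start a, ending in (y, y+g].
  palindromic-shared-start : ∀ {w K a y} g → 0 < g → K ≤ a → Palindromic w K y → Palindromic w K (y + g) →
                             ∃[ y′ ] y < y′ × y′ ≤ y + g × Palindromic w a y′
  palindromic-shared-start {w} {K} {a} {y} g@(suc _) _ K≤a p q =
    y + g ∸ h , y<y′ , m∸n≤m (y + g) h ,
    palindromic-concentric (proj₂ (palindromic-shift g j p q)) K+jg≤a a+y′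
    where
    h = (a ∸ K) % g
    j = (a ∸ K) / g
    h≤y+g : h ≤ y + g
    h≤y+g = ≤-trans (<⇒≤ (m%n<n (a ∸ K) g)) (m≤n+m g y)
    y<y′ : y < y + g ∸ h
    y<y′ = m+n≤o⇒m≤o∸n (suc y) (+-monoʳ-< y (m%n<n (a ∸ K) g))
    a≡ : a ≡ K + (h + j * g)
    a≡ = trans (sym (m+[n∸m]≡n K≤a)) (cong (K +_) (m≡m%n+[m/n]*n (a ∸ K) g))
    K+jg≤a : K + j * g ≤ a
    K+jg≤a = subst (K + j * g ≤_) (sym a≡) (+-monoʳ-≤ K (m≤n+m (j * g) h))
    rearrange : ∀ K h J z → K + (h + J) + z ≡ K + J + (z + h)
    rearrange = solve-∀
    a+y′ : a + (y + g ∸ h) ≡ K + j * g + (y + g)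
    a+y′ = begin
      a + (y + g ∸ h)                   ≡⟨ cong (_+ (y + g ∸ h)) a≡ ⟩
      K + (h + j * g) + (y + g ∸ h)     ≡⟨ rearrange K h (j * g) (y + g ∸ h) ⟩
      K + j * g + ((y + g ∸ h) + h)     ≡⟨ cong (K + j * g +_) (m∸n+n≡m h≤y+g) ⟩
      K + j * g + (y + g)               ∎
      where open ≡-Reasoning

  -- The palindrome w[a..e] supplies the extension: its concentric factor ending at y if that starts
  -- before x, and otherwise (by the maximality of y) the mirror image w[a..y] of w[x..e].
  palindromic-suffix-extends-left : ∀ {w a x y e} → a < x → y < e → Palindromic w a e → Palindromic w x e →
                                    (∀ r → y < r → r < e → ¬ Palindromic w x r) → ∃[ l ] l < x × Palindromic w l y
  palindromic-suffix-extends-left {w} {a} {x} {y} {e} a<x y<e outer inner maximal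
    with m≤n⇒∃[o]m+o≡n (<⇒≤ y<e)
  ... | δ , y+δ≡e with a + δ <? x
  ...   | yes a+δ<x = a + δ , a+δ<x , palindromic-concentric outer (m≤m+n a δ) (concentric-end y+δ≡e)
    where
    concentric-end : y + δ ≡ e → a + δ + y ≡ a + e
    concentric-end eq = trans (+-assoc a δ y) (cong (a +_) (trans (+-comm δ y) eq))
  ...   | no a+δ≮x with m≤n⇒∃[o]m+o≡n (<⇒≤ a<x)
  ...     | d , refl = a , a<x , subst (Palindromic w a) (sym y≡y₂) reflected
    where
    d≤δ : d ≤ δ
    d≤δ = +-cancelˡ-≤ a d δ (≮⇒≥ a+δ≮x)
    d≤e : d ≤ e
    d≤e = ≤-trans d≤δ (subst (δ ≤_) y+δ≡e (m≤n+m δ y))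
    y₂ = e ∸ d
    y₂+d : y₂ + d ≡ e
    y₂+d = m∸n+n≡m d≤e
    y₂<e : y₂ < e
    y₂<e = subst (y₂ <_) y₂+d (subst (_< y₂ + d) (+-identityʳ y₂)
             (+-monoʳ-< y₂ (+-cancelˡ-< a 0 d (subst (_< a + d) (sym (+-identityʳ a)) a<x))))
    centred : a + d + y₂ ≡ a + e
    centred = trans (+-assoc a d y₂) (cong (a +_) (trans (+-comm d y₂) y₂+d))
    y≡y₂ : y ≡ y₂
    y≡y₂ with y <? y₂
    ... | yes y<y₂ = ⊥-elim (maximal y₂ y<y₂ y₂<e (palindromic-concentric outer (m≤m+n a d) centred))
    ... | no y≮y₂  = ≤-antisym (+≡+⇒≤ʳ (trans y₂+d (sym y+δ≡e)) d≤δ) (≮⇒≥ y≮y₂)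
    reflected : Palindromic w a y₂
    reflected = palindromic-reflect outer inner (<⇒≤ a<x) ≤-refl refl centred

module Largest {P : ℕ → Set} (P? : ∀ m → Dec (P m)) (f : ℕ → ℕ) (f-zero : f 0 ≡ 0)
               (f-suc : ∀ k → f (suc k) ≡ (if does (P? (suc k)) then suc k else f k)) where

  largest-≤ : ∀ k → f k ≤ k
  largest-≤ zero = ≤-reflexive f-zero
  largest-≤ (suc k) with P? (suc k) | f-suc k
  ... | yes _ | eq = ≤-reflexive eq
  ... | no _  | eq = ≤-trans (≤-reflexive eq) (m≤n⇒m≤1+n (largest-≤ k))

  largest-holds : ∀ k → 0 < f k → P (f k)
  largest-holds zero pos = ⊥-elim (<-irrefl (sym f-zero) pos)
  largest-holds (suc k) pos with P? (suc k) | f-suc k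
  ... | yes p | eq = subst P (sym eq) p
  ... | no _  | eq = subst P (sym eq) (largest-holds k (subst (0 <_) eq pos))

  largest-maximal : ∀ k M → f k < M → M ≤ k → ¬ P M
  largest-maximal zero M lt le _ = <-irrefl refl (≤-trans (<-≤-trans (subst (_< M) f-zero lt) le) z≤n)
  largest-maximal (suc k) M lt le p with P? (suc k) | f-suc k
  ... | yes _  | eq = <-irrefl refl (<-≤-trans (subst (_< M) eq lt) le)
  ... | no ¬p  | eq with M ℕ.≟ suc k
  ...   | yes refl = ¬p p
  ...   | no M≢    = largest-maximal k M (subst (_< M) eq lt) (≤-pred (≤∧≢⇒< le M≢)) p

module Palindromes {A : Set} (_≟_ : DecidableEquality A) where

  open Strings _≟_

  private
    module Prefix (w : List A) = Largest (λ m → pal? (take m w)) (maxPalPre w) refl (λ _ → refl)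
    module Suffix (w : List A) = Largest (λ m → pal? (lastN m w)) (maxPalSuf w) refl (λ _ → refl)

  open Suffix using () renaming (largest-≤ to maxPalSuf-≤; largest-holds to maxPalSuf-palindrome;
                                  largest-maximal to maxPalSuf-maximal)

  slice-take-drop : ∀ (w : List A) x d → x + suc d ≤ length w → Slice (take (suc d) (drop x w)) w x (suc d)
  slice-take-drop w x d fits =
    slice-take (suc d) (slice-drop x (slice-self w)) (m+n≤o⇒m≤o∸n (suc d) (subst (_≤ length w) (+-comm x (suc d)) fits))

  slice-lastN-take : ∀ (w : List A) x d → x + d < length w → Slice (lastN (suc d) (take (suc (x + d)) w)) w x (suc d)
  slice-lastN-take w x d x+d<len = subst₂ (λ k L → Slice (drop k z) w x L) start length′ (slice-drop x σ)
    where
    z = take (suc (x + d)) w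
    σ : Slice z w 0 (suc (x + d))
    σ = slice-take (suc (x + d)) (slice-self w) x+d<len
    start : x ≡ length z ∸ suc d
    start = sym (trans (cong (_∸ suc d) (slice-length σ x+d<len)) (m+n∸n≡m x d))
    length′ : suc (x + d) ∸ x ≡ suc d
    length′ = trans (cong (_∸ x) (sym (+-suc x d))) (m+n∸m≡n x (suc d))

  length-lastN-take : ∀ (w : List A) x d y → x + d ≡ y → y < length w → length (lastN (suc d) (take (suc y) w)) ≡ suc d
  length-lastN-take w x d .(x + d) refl y<len =
    slice-length (slice-lastN-take w x d y<len) (subst (_≤ length w) (sym (+-suc x d)) y<len)

  take-drop-palindrome⇒ : ∀ (w : List A) x d → x + suc d ≤ length w →
                          IsPal (take (suc d) (drop x w)) → Palindromic w x (x + d)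
  take-drop-palindrome⇒ w x d fits = slice-palindrome⇒ (slice-take-drop w x d fits) fits

  take-drop-palindrome⇐ : ∀ (w : List A) x d → x + suc d ≤ length w →
                          Palindromic w x (x + d) → IsPal (take (suc d) (drop x w))
  take-drop-palindrome⇐ w x d fits = slice-palindrome⇐ (slice-take-drop w x d fits) fits

  lastN-take-palindrome⇒ : ∀ (w : List A) x d → x + d < length w →
                           IsPal (lastN (suc d) (take (suc (x + d)) w)) → Palindromic w x (x + d)
  lastN-take-palindrome⇒ w x d lt = slice-palindrome⇒ (slice-lastN-take w x d lt) (subst (_≤ length w) (sym (+-suc x d)) lt)

  lastN-take-palindrome⇐ : ∀ (w : List A) x d → x + d < length w →
                           Palindromic w x (x + d) → IsPal (lastN (suc d) (take (suc (x + d)) w))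
  lastN-take-palindrome⇐ w x d lt = slice-palindrome⇐ (slice-lastN-take w x d lt) (subst (_≤ length w) (sym (+-suc x d)) lt)

  private
    sub-length : ∀ l e → suc (l + e) ∸ l ≡ suc e
    sub-length l e = trans (cong (_∸ l) (sym (+-suc l e))) (m+n∸m≡n l (suc e))

  sub-palindrome⇒ : ∀ (w : List A) l r → l ≤ r → r < length w → IsPal (sub w (suc l) (suc r)) → Palindromic w l r
  sub-palindrome⇒ w l r l≤r r<len p with m≤n⇒∃[o]m+o≡n l≤r
  ... | e , refl = take-drop-palindrome⇒ w l e (subst (_≤ length w) (sym (+-suc l e)) r<len)
                     (subst (λ M → IsPal (take M (drop l w))) (sub-length l e) p)

  sub-palindrome⇐ : ∀ (w : List A) l r → l ≤ r → r < length w → Palindromic w l r → IsPal (sub w (suc l) (suc r))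
  sub-palindrome⇐ w l r l≤r r<len p with m≤n⇒∃[o]m+o≡n l≤r
  ... | e , refl = subst (λ M → IsPal (take M (drop l w))) (sym (sub-length l e))
                     (take-drop-palindrome⇐ w l e (subst (_≤ length w) (sym (+-suc l e)) r<len) p)

  record LongestPalindromeFrom (w : List A) (x d : ℕ) : Set where
    field
      fits            : x + suc d ≤ length w
      palindrome-from : Palindromic w x (x + d)
      longest         : ∀ d′ → x + suc d′ ≤ length w → Palindromic w x (x + d′) → d′ ≤ d

    no-right-extension : ∀ r → x + d < r → r < length w → ¬ Palindromic w x r
    no-right-extension r x+d<r r<len p with m≤n⇒∃[o]m+o≡n (≤-trans (m≤m+n x d) (<⇒≤ x+d<r))
    ... | d′ , refl = <⇒≱ (+-cancelˡ-< x d d′ x+d<r) (longest d′ (subst (_≤ length w) (sym (+-suc x d′)) r<len) p)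

  record LongestPalindromeTo (w : List A) (x y : ℕ) : Set where
    field
      start≤end     : x ≤ y
      palindrome-to : Palindromic w x y
      leftmost      : ∀ x′ → x′ ≤ y → Palindromic w x′ y → x ≤ x′

    no-left-extension : ∀ l → l < x → ¬ Palindromic w l y
    no-left-extension l l<x p = <⇒≱ l<x (leftmost l (≤-trans (<⇒≤ l<x) start≤end) p)

  open LongestPalindromeFrom public
  open LongestPalindromeTo public

  prelen-spec : ∀ (w : List A) x → x < length w → ∃[ d ] prelen w (suc x) ≡ suc d × LongestPalindromeFrom w x d
  prelen-spec w x x<len with prelen w (suc x) in eq
  ... | zero  = ⊥-elim (Prefix.largest-maximal z L 1 (subst (_< 1) (sym eq) z<s) 0<L (take-1-palindrome z))
    where
    z = drop x w
    L = length z
    0<L : 0 < L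
    0<L = subst (0 <_) (sym (length-drop x w)) (m<n⇒0<n∸m x<len)
    take-1-palindrome : ∀ (v : List A) → IsPal (take 1 v)
    take-1-palindrome []      = refl
    take-1-palindrome (_ ∷ _) = refl
  ... | suc d = d , refl , record { fits = fits′ ; palindrome-from = palindrome′ ; longest = longest′ }
    where
    z = drop x w
    L = length z
    suc-d≤L : suc d ≤ L
    suc-d≤L = subst (_≤ L) eq (Prefix.largest-≤ z L)
    fits′ : x + suc d ≤ length w
    fits′ = subst (_≤ length w) (+-comm (suc d) x)
              (m≤o∸n⇒m+n≤o (suc d) (<⇒≤ x<len) (subst (suc d ≤_) (length-drop x w) suc-d≤L))
    palindrome′ : Palindromic w x (x + d)
    palindrome′ = take-drop-palindrome⇒ w x d fits′
                    (subst (λ M → IsPal (take M z)) eq (Prefix.largest-holds z L (subst (0 <_) (sym eq) z<s)))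
    longest′ : ∀ d′ → x + suc d′ ≤ length w → Palindromic w x (x + d′) → d′ ≤ d
    longest′ d′ fits p with d′ ≤? d
    ... | yes d′≤d = d′≤d
    ... | no d′≰d  = ⊥-elim (Prefix.largest-maximal z L (suc d′) (subst (_< suc d′) (sym eq) (s≤s (≰⇒> d′≰d)))
                       (subst (suc d′ ≤_) (sym (length-drop x w)) (m+n≤o⇒m≤o∸n (suc d′) (subst (_≤ length w) (+-comm x (suc d′)) fits)))
                       (take-drop-palindrome⇐ w x d′ fits p))

  suflen-spec : ∀ (w : List A) y → y < length w →
                ∃[ x ] ∃[ d ] suflen w (suc y) ≡ suc d × x + d ≡ y × LongestPalindromeTo w x y
  suflen-spec w y y<len with suflen w (suc y) in eq
  ... | zero  = ⊥-elim (Suffix.largest-maximal z L 1 (subst (_< 1) (sym eq) z<s) (subst (1 ≤_) (sym L≡) (s≤s z≤n))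
                  (subst (λ v → IsPal (lastN 1 (take (suc v) w))) (+-identityʳ y)
                    (lastN-take-palindrome⇐ w y 0 (subst (_< length w) (sym (+-identityʳ y)) y<len)
                      (subst (Palindromic w y) (sym (+-identityʳ y)) (palindromic-single y)))))
    where
    z = take (suc y) w
    L = length z
    L≡ : L ≡ suc y
    L≡ = slice-length (slice-take (suc y) (slice-self w) y<len) y<len
  ... | suc d = x , d , refl , x+d≡y , record { start≤end = x≤y ; palindrome-to = palindrome′ ; leftmost = leftmost′ }
    where
    z = take (suc y) w
    L = length z
    L≡ : L ≡ suc y
    L≡ = slice-length (slice-take (suc y) (slice-self w) y<len) y<len
    d≤y : d ≤ y
    d≤y = ≤-pred (subst₂ _≤_ eq L≡ (Suffix.largest-≤ z L))
    x = y ∸ d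
    x+d≡y : x + d ≡ y
    x+d≡y = m∸n+n≡m d≤y
    x≤y : x ≤ y
    x≤y = m∸n≤m y d
    palindrome′ : Palindromic w x y
    palindrome′ = subst (Palindromic w x) x+d≡y
      (lastN-take-palindrome⇒ w x d (subst (_< length w) (sym x+d≡y) y<len)
        (subst (λ v → IsPal (lastN (suc d) (take (suc v) w))) (sym x+d≡y)
          (subst (λ M → IsPal (lastN M z)) eq (Suffix.largest-holds z L (subst (0 <_) (sym eq) z<s)))))
    leftmost′ : ∀ x′ → x′ ≤ y → Palindromic w x′ y → x ≤ x′
    leftmost′ x′ x′≤y p with x ≤? x′
    ... | yes x≤x′ = x≤x′
    ... | no x≰x′  = ⊥-elim (Suffix.largest-maximal z L (suc d′) (subst (_< suc d′) (sym eq) (s≤s d<d′))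
                       (subst (suc d′ ≤_) (sym L≡) (s≤s (m∸n≤m y x′)))
                       (subst (λ v → IsPal (lastN (suc d′) (take (suc v) w))) x′+d′≡y
                         (lastN-take-palindrome⇐ w x′ d′ (subst (_< length w) (sym x′+d′≡y) y<len)
                           (subst (Palindromic w x′) (sym x′+d′≡y) p))))
      where
      d′ = y ∸ x′
      x′+d′≡y : x′ + d′ ≡ y
      x′+d′≡y = m+[n∸m]≡n x′≤y
      d<d′ : d < d′
      d<d′ = +-cancelˡ-< x′ d d′ (subst (x′ + d <_) (trans x+d≡y (sym x′+d′≡y)) (+-monoˡ-< d (≰⇒> x≰x′)))

  -- A surface w[x..y] in 0-indexed positions, i.e. IsSurface w (suc x) (suc y).
  record Surface (w : List A) (x y : ℕ) : Set where
    field
      ordered       : x ≤ y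
      ends-inside   : y < length w
      palindrome    : Palindromic w x y
      right-maximal : ∀ r → y < r → r < length w → ¬ Palindromic w x r
      left-maximal  : ∀ l → l < x → ¬ Palindromic w l y

  open Surface public

  IsSurface⇒Surface : ∀ (w : List A) x y → IsSurface w (suc x) (suc y) → Surface w x y
  IsSurface⇒Surface w x y (_ , s≤s x≤y , y<len , pal , no-right , no-left) = record
    { ordered       = x≤y
    ; ends-inside   = y<len
    ; palindrome    = sub-palindrome⇒ w x y x≤y y<len pal
    ; right-maximal = λ r y<r r<len p →
        no-right (s≤s r<len) (s≤s y<r) (sub-palindrome⇐ w x r (≤-trans x≤y (<⇒≤ y<r)) r<len p)
    ; left-maximal  = λ l l<x p →
        no-left (s≤s l<x) (s≤s z≤n) (sub-palindrome⇐ w l y (≤-trans (<⇒≤ l<x) x≤y) y<len p) }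

  Surface⇒IsSurface : ∀ (w : List A) x y → Surface w x y → IsSurface w (suc x) (suc y)
  Surface⇒IsSurface w x y σ =
    s≤s z≤n , s≤s (ordered σ) , ends-inside σ , sub-palindrome⇐ w x y (ordered σ) (ends-inside σ) (palindrome σ) ,
    no-right , no-left
    where
    no-right : NoRightExt w (suc x) (suc y)
    no-right {suc r} (s≤s r<len) (s≤s y<r) p =
      right-maximal σ r y<r r<len (sub-palindrome⇒ w x r (≤-trans (ordered σ) (<⇒≤ y<r)) r<len p)
    no-left : NoLeftExt w (suc x) (suc y)
    no-left {suc l} (s≤s l<x) _ p =
      left-maximal σ l l<x (sub-palindrome⇒ w l y (≤-trans (<⇒≤ l<x) (ordered σ)) (ends-inside σ) p)

  Surface? : ∀ (w : List A) x y → Dec (Surface w x y)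
  Surface? w x y = map′ (IsSurface⇒Surface w x y) (Surface⇒IsSurface w x y) (surface? w (suc x) (suc y))

  private
    prefix-end : ∀ (w : List A) x d → prelen w (suc x) ≡ suc d → suc x + prelen w (suc x) ∸ 1 ≡ suc (x + d)
    prefix-end w x d eq = trans (cong (λ M → suc x + M ∸ 1) eq) (+-suc x d)

    suffix-start : ∀ (w : List A) x d y → suflen w (suc y) ≡ suc d → x + d ≡ y → suc (suc y) ∸ suflen w (suc y) ≡ suc x
    suffix-start w x d y eq x+d≡y = trans (cong (suc (suc y) ∸_) eq) (trans (cong (λ v → suc v ∸ d) (sym x+d≡y)) (m+n∸n≡m (suc x) d))

  presurf-surface : ∀ (w : List A) x d → prelen w (suc x) ≡ suc d → Surface w x (x + d) →
                    presurf w (suc x) ≡ take (suc d) (drop x w)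
  presurf-surface w x d eq σ =
    trans (cong (λ b → if b then prepal w (suc x) else [])
                (dec-true (surface? w (suc x) _)
                          (subst (IsSurface w (suc x)) (sym (prefix-end w x d eq)) (Surface⇒IsSurface w x (x + d) σ))))
          (cong (λ M → take M (drop x w)) eq)

  presurf-not-surface : ∀ (w : List A) x d → prelen w (suc x) ≡ suc d → ¬ Surface w x (x + d) → presurf w (suc x) ≡ []
  presurf-not-surface w x d eq ¬σ =
    cong (λ b → if b then prepal w (suc x) else [])
         (dec-false (surface? w (suc x) _)
                    (λ s → ¬σ (IsSurface⇒Surface w x (x + d) (subst (IsSurface w (suc x)) (prefix-end w x d eq) s))))

  sufsurf-surface : ∀ (w : List A) x d y → suflen w (suc y) ≡ suc d → x + d ≡ y → Surface w x y →
                    sufsurf w (suc y) ≡ lastN (suc d) (take (suc y) w)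
  sufsurf-surface w x d y eq x+d≡y σ =
    trans (cong (λ b → if b then sufpal w (suc y) else [])
                (dec-true (surface? w _ (suc y))
                          (subst (λ i → IsSurface w i (suc y)) (sym (suffix-start w x d y eq x+d≡y)) (Surface⇒IsSurface w x y σ))))
          (cong (λ M → lastN M (take (suc y) w)) eq)

  sufsurf-not-surface : ∀ (w : List A) x d y → suflen w (suc y) ≡ suc d → x + d ≡ y → ¬ Surface w x y →
                        sufsurf w (suc y) ≡ []
  sufsurf-not-surface w x d y eq x+d≡y ¬σ =
    cong (λ b → if b then sufpal w (suc y) else [])
         (dec-false (surface? w _ (suc y))
                    (λ s → ¬σ (IsSurface⇒Surface w x y (subst (λ i → IsSurface w i (suc y)) (suffix-start w x d y eq x+d≡y) s))))

  -- t = sufpal w (e + 1) = w[a..e], and t′ = w[b..e] (of length m) is its longest proper palindromic suffix,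
  -- with b = e + 1 when t′ is empty.
  record LastPalindromes (w : List A) (e : ℕ) : Set where
    field
      a b m         : ℕ
      start-t       : length w ∸ length (sufpal w (length w)) ≡ a
      length-t′     : length (properPalSuf (sufpal w (length w))) ≡ m
      a<b           : a < b
      b+m≡          : b + m ≡ suc e
      t-palindrome  : Palindromic w a e
      t-leftmost    : ∀ x → x < a → ¬ Palindromic w x e
      t′-palindrome : Palindromic w b e
      t′-longest    : ∀ x → a < x → x < b → ¬ Palindromic w x e
      t′-slice      : Slice (properPalSuf (sufpal w (length w))) w b m

  last-palindromes : ∀ (w : List A) e → length w ≡ suc e → LastPalindromes w e
  last-palindromes w e length-w with suflen-spec w e (subst (e <_) (sym length-w) ≤-refl)
  ... | a , d , eq , a+d≡e , T = record
    { a             = a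
    ; b             = a + k
    ; m             = mm
    ; start-t       = trans (cong₂ _∸_ length-w length-t) (trans (cong (_∸ d) (sym a+d≡e)) (m+n∸n≡m a d))
    ; length-t′     = slice-length t′-slice (≤-reflexive (trans b+m≡ (sym length-w)))
    ; a<b           = m<m+n a (m<n⇒0<n∸m (s≤s mm≤d))
    ; b+m≡          = b+m≡
    ; t-palindrome  = palindrome-to T
    ; t-leftmost    = no-left-extension T
    ; t′-palindrome = slice-palindromic mm t′-slice b+m≡ e<length (maxPalSuf-palindrome t (length t ∸ 1))
    ; t′-longest    = t′-longest
    ; t′-slice      = t′-slice }
    where
    e<length : e < length w
    e<length = subst (e <_) (sym length-w) ≤-refl
    t = sufpal w (length w)
    a+d<length : a + d < length w
    a+d<length = subst (_< length w) (sym a+d≡e) e<length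
    t-slice : Slice t w a (suc d)
    t-slice = subst (λ n → Slice (sufpal w n) w a (suc d)) (sym length-w)
                (subst (λ M → Slice (lastN M (take (suc e) w)) w a (suc d)) (sym eq)
                  (subst (λ y → Slice (lastN (suc d) (take (suc y) w)) w a (suc d)) a+d≡e
                    (slice-lastN-take w a d a+d<length)))
    length-t : length t ≡ suc d
    length-t = slice-length t-slice (subst (_≤ length w) (sym (+-suc a d)) a+d<length)
    length-t∸1 : length t ∸ 1 ≡ d
    length-t∸1 = cong (_∸ 1) length-t
    mm = maxPalSuf t (length t ∸ 1)
    mm≤d : mm ≤ d
    mm≤d = subst (mm ≤_) length-t∸1 (maxPalSuf-≤ t (length t ∸ 1))
    k = suc d ∸ mm
    k+mm : k + mm ≡ suc d
    k+mm = m∸n+n≡m (m≤n⇒m≤1+n mm≤d)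
    b+m≡ : a + k + mm ≡ suc e
    b+m≡ = trans (+-assoc a k mm) (trans (cong (a +_) k+mm) (trans (+-suc a d) (cong suc a+d≡e)))
    t′-slice : Slice (properPalSuf t) w (a + k) mm
    t′-slice = subst₂ (λ i L → Slice (drop i t) w (a + k) L) (sym (cong (_∸ mm) length-t)) (m∸[m∸n]≡n (m≤n⇒m≤1+n mm≤d))
                 (slice-drop k t-slice)
    t′-longest : ∀ x → a < x → x < a + k → ¬ Palindromic w x e
    t′-longest x a<x x<b p with m≤n⇒∃[o]m+o≡n (<⇒≤ a<x)
    ... | j , refl = maxPalSuf-maximal t (length t ∸ 1) (suc d″) mm<L L≤ pal
      where
      x≤e : a + j ≤ e
      x≤e = ≤-pred (<-≤-trans x<b (subst (a + k ≤_) b+m≡ (m≤m+n (a + k) mm)))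
      d″ = e ∸ (a + j)
      x+d″≡e : a + j + d″ ≡ e
      x+d″≡e = m+[n∸m]≡n x≤e
      j+d″≡d : j + d″ ≡ d
      j+d″≡d = +-cancelˡ-≡ a (j + d″) d (trans (sym (+-assoc a j d″)) (trans x+d″≡e (sym a+d≡e)))
      0<j : 0 < j
      0<j = +-cancelˡ-< a 0 j (subst (_< a + j) (sym (+-identityʳ a)) a<x)
      mm<L : mm < suc d″
      mm<L = +≡+⇒<ˡ {j} {suc d″} {k} {mm} (trans (+-suc j d″) (trans (cong suc j+d″≡d) (sym k+mm))) (+-cancelˡ-< a j k x<b)
      L≤ : suc d″ ≤ length t ∸ 1
      L≤ = subst (suc d″ ≤_) (trans j+d″≡d (sym length-t∸1)) (+-monoˡ-≤ d″ 0<j)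
      start : length t ∸ suc d″ ≡ j
      start = trans (cong (_∸ suc d″) length-t) (trans (cong (_∸ d″) (sym j+d″≡d)) (m+n∸n≡m j d″))
      len : suc d ∸ j ≡ suc d″
      len = trans (cong (λ v → suc v ∸ j) (sym j+d″≡d)) (trans (cong (_∸ j) (sym (+-suc j d″))) (m+n∸m≡n j (suc d″)))
      slice : Slice (lastN (suc d″) t) w (a + j) (suc d″)
      slice = subst₂ (λ i L → Slice (drop i t) w (a + j) L) (sym start) len (slice-drop j t-slice)
      pal : IsPal (lastN (suc d″) t)
      pal = slice-palindrome⇐ slice (subst (_≤ length w) (sym (+-suc (a + j) d″)) (subst (_< length w) (sym x+d″≡e) e<length))
              (subst (Palindromic w (a + j)) (sym x+d″≡e) p)

-- w′ is w without its last letter w[e]. Positions are 0-indexed, so presurf and sufsurf are taken at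
-- suc x; X is the sufsurf of the statement, taken at the (0-indexed) position c = a + m − 1.
module Deletion {A : Set} (_≟_ : DecidableEquality A) (w : List A) (e : ℕ) (length-w : length w ≡ suc e) where

  open Strings _≟_
  open Palindromes _≟_
  open LastPalindromes (last-palindromes w e length-w) public

  t′ : List A
  t′ = properPalSuf (sufpal w (length w))

  w′ : List A
  w′ = take e w

  X : List A
  X = sufsurf w (a + m)

  e≤length-w : e ≤ length w
  e≤length-w = subst (e ≤_) (sym length-w) (n≤1+n e)

  e<length-w : e < length w
  e<length-w = subst (e <_) (sym length-w) ≤-refl

  length-w′ : length w′ ≡ e
  length-w′ = trans (length-take e w) (m≤n⇒m⊓n≡m e≤length-w)

  agree : ∀ k → k < e → index w′ k ≡ index w k
  agree = index-take-< w e

  <e⇒<length-w : ∀ {k} → k < e → k < length w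
  <e⇒<length-w k<e = ≤-trans k<e e≤length-w

  <e⇒<length-w′ : ∀ {k} → k < e → k < length w′
  <e⇒<length-w′ {k} = subst (k <_) (sym length-w′)

  <length-w′⇒<e : ∀ {k} → k < length w′ → k < e
  <length-w′⇒<e {k} = subst (k <_) length-w′

  to-w : ∀ {x y} → y < e → Palindromic w′ x y → Palindromic w x y
  to-w = palindromic-transfer agree

  to-w′ : ∀ {x y} → y < e → Palindromic w x y → Palindromic w′ x y
  to-w′ = palindromic-transfer (λ k k<e → sym (agree k k<e))

  prefix-agree : ∀ x d → x + suc d ≤ e → take (suc d) (drop x w′) ≡ take (suc d) (drop x w)
  prefix-agree x d fits = slice-≡ (slice-take-drop w′ x d (subst (x + suc d ≤_) (sym length-w′) fits))
                                  (slice-take-drop w x d (≤-trans fits e≤length-w))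
                                  (λ k k<d → agree (x + k) (<-≤-trans (+-monoʳ-< x k<d) fits))

  suffix-agree : ∀ x d y → x + d ≡ y → y < e → lastN (suc d) (take (suc y) w′) ≡ lastN (suc d) (take (suc y) w)
  suffix-agree x d .(x + d) refl x+d<e = slice-≡ (slice-lastN-take w′ x d (<e⇒<length-w′ x+d<e))
                                                 (slice-lastN-take w x d (<e⇒<length-w x+d<e))
                                                 (λ k k<d → agree (x + k) (≤-<-trans (+-monoʳ-≤ x (≤-pred k<d)) x+d<e))

  surface-restrict : ∀ {x y} → y < e → Surface w x y → Surface w′ x y
  surface-restrict {x} {y} y<e σ = record
    { ordered       = ordered σ
    ; ends-inside   = <e⇒<length-w′ y<e
    ; palindrome    = to-w′ y<e (palindrome σ)
    ; right-maximal = λ r y<r r<len p →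
        right-maximal σ r y<r (<e⇒<length-w (<length-w′⇒<e r<len)) (to-w (<length-w′⇒<e r<len) p)
    ; left-maximal  = λ l l<x p → left-maximal σ l l<x (to-w y<e p) }

  surface-extend : ∀ {x y} → y < e → Surface w′ x y → ¬ Palindromic w x e → Surface w x y
  surface-extend {x} {y} y<e σ ¬x-e = record
    { ordered       = ordered σ
    ; ends-inside   = <e⇒<length-w y<e
    ; palindrome    = to-w y<e (palindrome σ)
    ; right-maximal = right-maximal′
    ; left-maximal  = λ l l<x p → left-maximal σ l l<x (to-w′ y<e p) }
    where
    right-maximal′ : ∀ r → y < r → r < length w → ¬ Palindromic w x r
    right-maximal′ r y<r r<len with m≤n⇒m<n∨m≡n (≤-pred (subst (r <_) length-w r<len))
    ... | inj₁ r<e  = λ p → right-maximal σ r y<r (<e⇒<length-w′ r<e) (to-w′ r<e p)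
    ... | inj₂ refl = ¬x-e

  right-maximal-below-e : ∀ {x y} → Surface w′ x y → ∀ r → y < r → r < e → ¬ Palindromic w x r
  right-maximal-below-e σ r y<r r<e p = right-maximal σ r y<r (<e⇒<length-w′ r<e) (to-w′ r<e p)

  longest-prefix-unchanged : ∀ {x d d′} → x + d < e → LongestPalindromeFrom w x d → LongestPalindromeFrom w′ x d′ → d′ ≡ d
  longest-prefix-unchanged {x} {d} {d′} x+d<e L L′ = ≤-antisym
    (longest L d′ (≤-trans fits′ e≤length-w) (to-w x+d′<e (palindrome-from L′)))
    (longest L′ d (subst (x + suc d ≤_) (sym length-w′) (subst (_≤ e) (sym (+-suc x d)) x+d<e)) (to-w′ x+d<e (palindrome-from L)))
    where
    fits′ : x + suc d′ ≤ e
    fits′ = subst (x + suc d′ ≤_) length-w′ (fits L′)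
    x+d′<e : x + d′ < e
    x+d′<e = subst (_≤ e) (+-suc x d′) fits′

  leftmost-unchanged : ∀ {x y x′} → y < e → LongestPalindromeTo w x y → LongestPalindromeTo w′ x′ y → x′ ≡ x
  leftmost-unchanged y<e T T′ = ≤-antisym
    (leftmost T′ _ (start≤end T) (to-w′ y<e (palindrome-to T)))
    (leftmost T _ (start≤end T′) (to-w y<e (palindrome-to T′)))

  presurf-before-end : ∀ x d → x + d < e → prelen w (suc x) ≡ suc d → LongestPalindromeFrom w x d →
                       presurf w′ (suc x) ≡ presurf w (suc x)
  presurf-before-end x d x+d<e eq L with prelen-spec w′ x (<e⇒<length-w′ (≤-<-trans (m≤m+n x d) x+d<e))
  ... | d′ , eq′ , L′ with longest-prefix-unchanged x+d<e L L′
  ... | refl with Surface? w x (x + d)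
  ... | yes σ = begin
    presurf w′ (suc x)       ≡⟨ presurf-surface w′ x d eq′ (surface-restrict x+d<e σ) ⟩
    take (suc d) (drop x w′) ≡⟨ prefix-agree x d (subst (_≤ e) (sym (+-suc x d)) x+d<e) ⟩
    take (suc d) (drop x w)  ≡⟨ presurf-surface w x d eq σ ⟨
    presurf w (suc x)        ∎
    where open ≡-Reasoning
  ... | no ¬σ = trans (presurf-not-surface w′ x d eq′ ¬σ′) (sym (presurf-not-surface w x d eq ¬σ))
    where
    ¬σ′ : ¬ Surface w′ x (x + d)
    ¬σ′ σ′ = ¬σ (surface-extend x+d<e σ′ (no-right-extension L e x+d<e e<length-w))

  presurf-reaching-end : ∀ x d → x < e → x ≢ a → x + d ≡ e → prelen w (suc x) ≡ suc d → LongestPalindromeFrom w x d →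
                         presurf w′ (suc x) ≡ presurf w (suc x)
  presurf-reaching-end x d x<e x≢a x+d≡e eq L with prelen-spec w′ x (<e⇒<length-w′ x<e)
  ... | d′ , eq′ , L′ = trans (presurf-not-surface w′ x d′ eq′ ¬σ′) (sym (presurf-not-surface w x d eq ¬σ))
    where
    x-e : Palindromic w x e
    x-e = subst (Palindromic w x) x+d≡e (palindrome-from L)
    a<x : a < x
    a<x with <-cmp a x
    ... | tri< a<x _ _ = a<x
    ... | tri≈ _ a≡x _ = ⊥-elim (x≢a (sym a≡x))
    ... | tri> _ _ x<a = ⊥-elim (t-leftmost x x<a x-e)
    ¬σ : ¬ Surface w x (x + d)
    ¬σ σ = left-maximal σ a a<x (subst (Palindromic w a) (sym x+d≡e) t-palindrome)
    x+d′<e : x + d′ < e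
    x+d′<e = subst (_≤ e) (+-suc x d′) (subst (x + suc d′ ≤_) length-w′ (fits L′))
    ¬σ′ : ¬ Surface w′ x (x + d′)
    ¬σ′ σ′ with palindromic-suffix-extends-left a<x x+d′<e t-palindrome x-e (right-maximal-below-e σ′)
    ... | l , l<x , p = left-maximal σ′ l l<x (to-w′ x+d′<e p)

  presurf-away : ∀ x → x < e → x ≢ a → presurf w′ (suc x) ≡ presurf w (suc x)
  presurf-away x x<e x≢a with prelen-spec w x (<e⇒<length-w x<e)
  ... | d , eq , L with m≤n⇒m<n∨m≡n (≤-pred (subst₂ _≤_ (+-suc x d) length-w (fits L)))
  ...   | inj₁ x+d<e = presurf-before-end x d x+d<e eq L
  ...   | inj₂ x+d≡e = presurf-reaching-end x d x<e x≢a x+d≡e eq L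

  t′-nonempty : a < e → ∃[ m′ ] m ≡ suc m′
  t′-nonempty a<e = nonzero m b+m≡
    where
    nonzero : ∀ k → b + k ≡ suc e → ∃[ m′ ] k ≡ suc m′
    nonzero (suc k) _     = k , refl
    nonzero zero    b+0≡ = ⊥-elim (t′-longest e a<e (≤-reflexive (sym (trans (sym (+-identityʳ b)) b+0≡))) (palindromic-single e))

  -- With t′ = w[b..e] nonempty, its mirror image in t = w[a..e] is w[a..c].
  module Mirror (m′ : ℕ) (m≡ : m ≡ suc m′) where

    c : ℕ
    c = a + m′

    b+m′≡e : b + m′ ≡ e
    b+m′≡e = suc-injective (trans (sym (+-suc b m′)) (subst (λ k → b + k ≡ suc e) m≡ b+m≡))

    c<e : c < e
    c<e = subst (c <_) b+m′≡e (+-monoˡ-< m′ a<b)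

    a≤c : a ≤ c
    a≤c = m≤m+n a m′

    a+m≡suc-c : a + m ≡ suc c
    a+m≡suc-c = trans (cong (a +_) m≡) (+-suc a m′)

    centred : b + c ≡ a + e
    centred = trans (rearrange b a m′) (cong (a +_) b+m′≡e)
      where
      rearrange : ∀ x y z → x + (y + z) ≡ y + (x + z)
      rearrange = solve-∀

    mirror-palindrome : Palindromic w a c
    mirror-palindrome = palindromic-reflect t-palindrome t′-palindrome (<⇒≤ a<b) ≤-refl refl centred

    no-palindrome-from-a : ∀ y → c < y → y < e → ¬ Palindromic w a y
    no-palindrome-from-a y c<y y<e p = t′-longest x a<x x<b (palindromic-reflect t-palindrome p ≤-refl (<⇒≤ y<e) x+y≡ refl)
      where
      x = a + e ∸ y
      x+y≡ : x + y ≡ a + e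
      x+y≡ = m∸n+n≡m (≤-trans (<⇒≤ y<e) (m≤n+m e a))
      a<x : a < x
      a<x = +≡+⇒<ˡ (trans (+-comm y x) (trans x+y≡ (+-comm a e))) y<e
      x<b : x < b
      x<b = +≡+⇒<ˡ {c} {b} {y} {x} (trans (+-comm c b) (trans centred (trans (sym x+y≡) (+-comm x y)))) c<y

    mirror-slice : ∀ {z} → Slice z w′ a (suc m′) → z ≡ t′
    mirror-slice σ = slice-≡ σ (subst (Slice t′ w b) m≡ t′-slice) matches
      where
      matches : ∀ k → k < suc m′ → index w′ (a + k) ≡ index w (b + k)
      matches k k<m = begin
        index w′ (a + k) ≡⟨ agree (a + k) (≤-<-trans (+-monoʳ-≤ a k≤m′) c<e) ⟩
        index w (a + k)  ≡⟨ mirror t-palindrome (a + k) v (around a) (m≤m+n a k) (≤-trans (+-monoʳ-≤ a k≤m′) (<⇒≤ c<e)) ⟩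
        index w v        ≡⟨ mirror t′-palindrome (b + k) v (around b) (m≤m+n b k) (subst (b + k ≤_) b+m′≡e (+-monoʳ-≤ b k≤m′)) ⟨
        index w (b + k)  ∎
        where
        open ≡-Reasoning
        k≤m′ : k ≤ m′
        k≤m′ = ≤-pred k<m
        v = e ∸ k
        around : ∀ x → x + k + v ≡ x + e
        around x = trans (+-assoc x k v) (cong (x +_) (m+[n∸m]≡n (≤-trans k≤m′ (subst (m′ ≤_) b+m′≡e (m≤n+m m′ b)))))

    longest-prefix-at-a : ∀ {d′} → LongestPalindromeFrom w′ a d′ → d′ ≡ m′
    longest-prefix-at-a {d′} L = ≤-antisym d′≤m′
      (longest L m′ (subst (a + suc m′ ≤_) (sym length-w′) (subst (_≤ e) (sym (+-suc a m′)) c<e)) (to-w′ c<e mirror-palindrome))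
      where
      a+d′<e : a + d′ < e
      a+d′<e = subst (_≤ e) (+-suc a d′) (subst (a + suc d′ ≤_) length-w′ (fits L))
      d′≤m′ : d′ ≤ m′
      d′≤m′ with d′ ≤? m′
      ... | yes d′≤m′ = d′≤m′
      ... | no d′≰m′  = ⊥-elim (no-palindrome-from-a (a + d′) (+-monoʳ-< a (≰⇒> d′≰m′)) a+d′<e (to-w a+d′<e (palindrome-from L)))

    surface-left-of-a : ∀ {K} → K < a → LongestPalindromeTo w K c → Surface w K c
    surface-left-of-a {K} K<a T = record
      { ordered       = start≤end T
      ; ends-inside   = <e⇒<length-w c<e
      ; palindrome    = palindrome-to T
      ; right-maximal = right-maximal′
      ; left-maximal  = no-left-extension T }
      where
      right-maximal′ : ∀ r → c < r → r < length w → ¬ Palindromic w K r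
      right-maximal′ r c<r r<len p with m≤n⇒m<n∨m≡n (≤-pred (subst (r <_) length-w r<len))
      ... | inj₂ refl = t-leftmost K K<a p
      ... | inj₁ r<e with m≤n⇒∃[o]m+o≡n (<⇒≤ c<r)
      ...   | g , refl with palindromic-shared-start g (+-cancelˡ-< c 0 g (subst (_< c + g) (sym (+-identityʳ c)) c<r))
                              (<⇒≤ K<a) (palindrome-to T) p
      ...     | y′ , c<y′ , y′≤r , a-y′ = no-palindrome-from-a y′ c<y′ (≤-<-trans y′≤r r<e) a-y′

    X-empty : ∀ {d} → suflen w (suc c) ≡ suc d → a + d ≡ c → X ≡ []
    X-empty {d} eq a+d≡c = trans (cong (sufsurf w) a+m≡suc-c)
      (sufsurf-not-surface w a d c eq a+d≡c (λ σ → right-maximal σ e c<e e<length-w t-palindrome))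

    X-short⇒leftmost-is-a : ∀ {K d} → suflen w (suc c) ≡ suc d → K + d ≡ c → LongestPalindromeTo w K c →
                             length X < m → K ≡ a
    X-short⇒leftmost-is-a {K} {d} eq K+d≡c T short with <-cmp K a
    ... | tri≈ _ K≡a _ = K≡a
    ... | tri> _ _ a<K = ⊥-elim (<⇒≱ a<K (leftmost T a a≤c mirror-palindrome))
    ... | tri< K<a _ _ = ⊥-elim (<⇒≱ short (subst (m ≤_) (sym length-X) (subst (_≤ suc d) (sym m≡) (s≤s (<⇒≤ m′<d)))))
      where
      m′<d : m′ < d
      m′<d = +≡+⇒<ˡ K+d≡c K<a
      length-X : length X ≡ suc d
      length-X = begin
        length X                                ≡⟨ cong (length ∘ sufsurf w) a+m≡suc-c ⟩
        length (sufsurf w (suc c))              ≡⟨ cong length (sufsurf-surface w K d c eq K+d≡c (surface-left-of-a K<a T)) ⟩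
        length (lastN (suc d) (take (suc c) w)) ≡⟨ length-lastN-take w K d c K+d≡c (<e⇒<length-w c<e) ⟩
        suc d                                   ∎
        where open ≡-Reasoning

    mirror-surface : length X < m → Surface w′ a c
    mirror-surface short with suflen-spec w c (<e⇒<length-w c<e)
    ... | K , d , eq , K+d≡c , T with X-short⇒leftmost-is-a eq K+d≡c T short
    ... | refl = record
      { ordered       = a≤c
      ; ends-inside   = <e⇒<length-w′ c<e
      ; palindrome    = to-w′ c<e mirror-palindrome
      ; right-maximal = λ r c<r r<len p → no-palindrome-from-a r c<r (<length-w′⇒<e r<len) (to-w (<length-w′⇒<e r<len) p)
      ; left-maximal  = λ l l<a p → no-left-extension T l l<a (to-w c<e p) }

    presurf-at-a-short : length X < m → presurf w′ (suc a) ≡ t′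
    presurf-at-a-short short with prelen-spec w′ a (<e⇒<length-w′ (≤-<-trans a≤c c<e))
    ... | d′ , eq′ , L′ with longest-prefix-at-a L′
    ... | refl = trans (presurf-surface w′ a m′ eq′ (mirror-surface short)) (mirror-slice (slice-take-drop w′ a m′ (fits L′)))

    presurf-at-a-long : m ≤ length X → presurf w′ (suc a) ≡ []
    presurf-at-a-long long with prelen-spec w′ a (<e⇒<length-w′ (≤-<-trans a≤c c<e))
    ... | d′ , eq′ , L′ with longest-prefix-at-a L′
    ... | refl = presurf-not-surface w′ a m′ eq′ ¬σ
      where
      ¬σ : ¬ Surface w′ a c
      ¬σ σ with suflen-spec w c (<e⇒<length-w c<e)
      ... | K , d , eq , K+d≡c , T with <-cmp K a
      ...   | tri< K<a _ _ = left-maximal σ K K<a (to-w′ c<e (palindrome-to T))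
      ...   | tri> _ _ a<K = <⇒≱ a<K (leftmost T a a≤c mirror-palindrome)
      ...   | tri≈ _ refl _ with subst₂ _≤_ m≡ (cong length (X-empty eq K+d≡c)) long
      ...     | ()

    sufsurf-at-c : ∀ x → suc x ≡ a + m → length X < m → sufsurf w′ (suc x) ≡ t′
    sufsurf-at-c x suc-x≡ short with suc-injective (trans suc-x≡ a+m≡suc-c)
    ... | refl with suflen-spec w c (<e⇒<length-w c<e) | suflen-spec w′ c (<e⇒<length-w′ c<e)
    ... | K , d , eq , K+d≡c , T | K′ , d′ , eq′ , K′+d′≡c , T′
      with X-short⇒leftmost-is-a eq K+d≡c T short | leftmost-unchanged c<e T T′
    ... | refl | refl with +-cancelˡ-≡ a d′ m′ K′+d′≡c
    ... | refl = trans (sufsurf-surface w′ a m′ c eq′ refl (mirror-surface short))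
                       (mirror-slice (slice-lastN-take w′ a m′ (<e⇒<length-w′ c<e)))

    ends-at-c : ∀ x d → x < e → suflen w (suc x) ≡ suc d → a + d ≡ x → Palindromic w a x →
                (∀ r → x < r → r < e → ¬ Palindromic w a r) → suc x ≡ a + m × length X < m
    ends-at-c x d x<e eq a+d≡x a-x right-maximal′ with <-cmp x c
    ... | tri< x<c _ _ = ⊥-elim (right-maximal′ c x<c c<e mirror-palindrome)
    ... | tri> _ _ c<x = ⊥-elim (no-palindrome-from-a x c<x x<e a-x)
    ... | tri≈ _ refl _ = sym a+m≡suc-c , subst (_< m) (sym (cong length (X-empty eq a+d≡x))) (subst (0 <_) (sym m≡) z<s)

  positive : ∀ {j k} → j < k → ∃[ k′ ] k ≡ suc k′
  positive {k = suc k′} _ = k′ , refl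

  presurf-at-start-short : length X < m → presurf w′ (suc a) ≡ t′
  presurf-at-start-short short with positive short
  ... | m′ , m≡ = Mirror.presurf-at-a-short m′ m≡ short

  presurf-at-start-long : a < e → m ≤ length X → presurf w′ (suc a) ≡ []
  presurf-at-start-long a<e long with t′-nonempty a<e
  ... | m′ , m≡ = Mirror.presurf-at-a-long m′ m≡ long

  sufsurf-at-mirror-end : ∀ x → suc x ≡ a + m → length X < m → sufsurf w′ (suc x) ≡ t′
  sufsurf-at-mirror-end x suc-x≡ short with positive short
  ... | m′ , m≡ = Mirror.sufsurf-at-c m′ m≡ x suc-x≡ short

  not-reaching-e : ∀ {K d x} → x < e → suflen w (suc x) ≡ suc d → K + d ≡ x → LongestPalindromeTo w K x →
                   ¬ (suc x ≡ a + m × length X < m) → Surface w′ K x → ¬ Palindromic w K e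
  not-reaching-e {K} {d} {x} x<e eq K+d≡x T away σ′ K-e with <-cmp K a
  ... | tri< K<a _ _ = t-leftmost K K<a K-e
  ... | tri> _ _ a<K with palindromic-suffix-extends-left a<K x<e t-palindrome K-e (right-maximal-below-e σ′)
  ...   | l , l<K , p = no-left-extension T l l<K p
  not-reaching-e {K} {d} {x} x<e eq K+d≡x T away σ′ K-e | tri≈ _ refl _ with t′-nonempty (≤-<-trans (start≤end T) x<e)
  ... | m′ , m≡ = away (Mirror.ends-at-c m′ m≡ x d x<e eq K+d≡x (palindrome-to T) (right-maximal-below-e σ′))

  sufsurf-away : ∀ x → x < e → ¬ (suc x ≡ a + m × length X < m) → sufsurf w′ (suc x) ≡ sufsurf w (suc x)
  sufsurf-away x x<e away with suflen-spec w x (<e⇒<length-w x<e) | suflen-spec w′ x (<e⇒<length-w′ x<e)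
  ... | K , d , eq , K+d≡x , T | K′ , d′ , eq′ , K′+d′≡x , T′ with leftmost-unchanged x<e T T′
  ... | refl with +-cancelˡ-≡ K d′ d (trans K′+d′≡x (sym K+d≡x))
  ... | refl with Surface? w K x
  ... | yes σ = begin
    sufsurf w′ (suc x)               ≡⟨ sufsurf-surface w′ K d x eq′ K+d≡x (surface-restrict x<e σ) ⟩
    lastN (suc d) (take (suc x) w′)  ≡⟨ suffix-agree K d x K+d≡x x<e ⟩
    lastN (suc d) (take (suc x) w)   ≡⟨ sufsurf-surface w K d x eq K+d≡x σ ⟨
    sufsurf w (suc x)                ∎
    where open ≡-Reasoning
  ... | no ¬σ = trans (sufsurf-not-surface w′ K d x eq′ K+d≡x ¬σ′) (sym (sufsurf-not-surface w K d x eq K+d≡x ¬σ))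
    where
    ¬σ′ : ¬ Surface w′ K x
    ¬σ′ σ′ = ¬σ (surface-extend x<e σ′ (not-reaching-e x<e eq K+d≡x T away σ′))

length-nonempty : ∀ {A : Set} (s : List A) → s ≢ [] → length s ≡ suc (length s ∸ 1)
length-nonempty []      s≢[] = ⊥-elim (s≢[] refl)
length-nonempty (_ ∷ _) _    = refl

lemma25 : {A : Set} (_≟_ : DecidableEquality A) (s : List A) → s ≢ [] →
    let open Strings _≟_
        n  = length s
        s′ = take (n ∸ 1) s
        t  = sufpal s n
        t′ = properPalSuf t
        p  = n ∸ length t + 1
        q  = n ∸ length t + length t′
        X  = sufsurf s q
    in (i : ℕ) → 1 ≤ i → i ≤ n ∸ 1 →
       ((i ≡ p → length X < length t′ → presurf s′ i ≡ t′)
        × (i ≡ p → length X ≥ length t′ → presurf s′ i ≡ [])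
        × (i ≢ p → presurf s′ i ≡ presurf s i))
       × ((i ≡ q → length X < length t′ → sufsurf s′ i ≡ t′)
        × (¬ (i ≡ q × length X < length t′) → sufsurf s′ i ≡ sufsurf s i))
lemma25 _≟_ s s≢[] (suc x) _ x<e =
  ( (λ i≡p short → subst (λ i → presurf w′ (suc i) ≡ t′) (sym (x≡a i≡p)) (presurf-at-start-short (X-short short)))
  , (λ i≡p long → subst (λ i → presurf w′ (suc i) ≡ []) (sym (x≡a i≡p))
                    (presurf-at-start-long (subst (_< e) (x≡a i≡p) x<e) (subst₂ _≤_ length-t′ X≡ long)))
  , (λ i≢p → presurf-away x x<e (λ x≡a → i≢p (trans (cong suc x≡a) (sym p≡))))
  ) ,
  ( (λ i≡q short → sufsurf-at-mirror-end x (trans i≡q q≡) (X-short short))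
  , (λ away → sufsurf-away x x<e (λ (i≡ , short) → away (trans i≡ (sym q≡) , subst₂ _<_ (sym X≡) (sym length-t′) short)))
  )
  where
  open Strings _≟_
  e = length s ∸ 1
  open Deletion _≟_ s e (length-nonempty s s≢[])
  p≡ : length s ∸ length (sufpal s (length s)) + 1 ≡ suc a
  p≡ = trans (cong (_+ 1) start-t) (+-comm a 1)
  x≡a : suc x ≡ length s ∸ length (sufpal s (length s)) + 1 → x ≡ a
  x≡a i≡p = suc-injective (trans i≡p p≡)
  q≡ : length s ∸ length (sufpal s (length s)) + length t′ ≡ a + m
  q≡ = cong₂ _+_ start-t length-t′
  X≡ : length (sufsurf s (length s ∸ length (sufpal s (length s)) + length t′)) ≡ length X
  X≡ = cong (length ∘ sufsurf s) q≡
  X-short : length (sufsurf s (length s ∸ length (sufpal s (length s)) + length t′)) < length t′ → length X < m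
  X-short = subst₂ _<_ X≡ length-t′
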